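{- Let $n\ge 0$ and let $x,y \in \mathbb{Z}[i]$. If $xy \in B_n \setminus \{0\}$, then $x \in B_n$.
   Context: For $n\ge 0$, $B_n = \left\{ \sum_{j=0}^n v_j (1+i)^j : v_j \in \{0,\pm 1,\pm i\}\right\} \subset \mathbb{Z}[i]$. -}

module Defs where

open import Data.Integer using (ℤ; +_; -_) renaming (_+_ to _+ℤ_; _*_ to _*ℤ_; _-_ to _-ℤ_)
open import Data.Nat using (ℕ; suc)
open import Data.Vec using (Vec; []; _∷_)
open import Data.Product using (Σ; _,_)
open import Relation.Binary.PropositionalEquality using (_≡_)

record ℤ[i] : Set where
  constructor _+_i
  field
    re : ℤ
    im : ℤ
open ℤ[i] public

0ᵍ : ℤ[i]
0ᵍ = (+ 0) + (+ 0) i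

1ᵍ : ℤ[i]
1ᵍ = (+ 1) + (+ 0) i

iᵍ : ℤ[i]
iᵍ = (+ 0) + (+ 1) i

_+ᵍ_ : ℤ[i] → ℤ[i] → ℤ[i]
(a + b i) +ᵍ (c + d i) = (a +ℤ c) + (b +ℤ d) i

_*ᵍ_ : ℤ[i] → ℤ[i] → ℤ[i]
(a + b i) *ᵍ (c + d i) = ((a *ℤ c) -ℤ (b *ℤ d)) + ((a *ℤ d) +ℤ (b *ℤ c)) i

β : ℤ[i]
β = (+ 1) + (+ 1) i

data Digit : Set where
  d0 d1 d-1 di d-i : Digit

digitVal : Digit → ℤ[i]
digitVal d0  = 0ᵍ
digitVal d1  = 1ᵍ
digitVal d-1 = (- (+ 1)) + (+ 0) i
digitVal di  = iᵍ
digitVal d-i = (+ 0) + (- (+ 1)) i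

-- value of digits v_0, v_1, …, v_k : Σ_j v_j (1+i)^j  (Horner form)
evalDigits : ∀ {k} → Vec Digit k → ℤ[i]
evalDigits []       = 0ᵍ
evalDigits (v ∷ vs) = digitVal v +ᵍ (β *ᵍ evalDigits vs)

B : ℕ → ℤ[i] → Set
B n z = Σ (Vec Digit (suc n)) (λ v → evalDigits v ≡ z)

{-# OPTIONS --safe #-}
module Submission where

-- Write β = 1 + i and call z odd when z ≡ 1 modulo β. If β divides y, then the units digit of
-- x y is 0; dropping it expands x (y / β) with one digit fewer, and we recurse (x y ≢ 0 stops
-- the digits from running out). If y is an odd unit, multiplying every digit of x y by the digit
-- y⁻¹ expands x. Otherwise |y|² ≥ 5. Read in pairs, the digits form a base-β² = 2i expansion with
-- digits of norm ≤ 5, whence |x y|² < 5·2^(n+1) and |x|² < 2^(n+1). Finally every z with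
-- |z|² < 2^k has k digits: z = β w, or z = u + β w for a unit u with |z - u| < |z|, and in both
-- cases |w|² < 2^(k-1).

open import Defs
open import Level using (0ℓ)
open import Algebra.Bundles using (CommutativeRing)
open import Data.Empty using (⊥-elim)
open import Function using (_∘_)
open import Data.Integer as ℤ using (ℤ; +_; -[1+_]; +[1+_]; +0; _+_; _*_; _-_; -_; ∣_∣; +≤+; -≤+)
open import Data.Integer.DivMod using (_%ℕ_; _/ℕ_; n%ℕd<d; a≡a%ℕn+[a/ℕn]*n)
import Data.Integer.Properties as ℤ
import Data.Integer.Tactic.RingSolver as ℤ-Solver
open import Data.Maybe using (Maybe; just; nothing)
open import Data.Nat as ℕ using (ℕ; zero; suc; z≤n; s≤s; _^_)
import Data.Nat.Properties as ℕ
import Data.Nat.Tactic.RingSolver as ℕ-Solver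
open import Data.Product using (Σ; ∃-syntax; _×_; _,_; map₂)
open import Data.Sum using (_⊎_; inj₁; inj₂)
open import Data.Vec using (Vec; []; _∷_; _∷ʳ_; map)
open import Relation.Binary.PropositionalEquality
open import Relation.Nullary using (¬_; yes; no)
open import Tactic.RingSolver using (solve-∀)
open import Tactic.RingSolver.Core.AlmostCommutativeRing using (AlmostCommutativeRing; fromCommutativeRing)

infix 8 -ᵍ_
-ᵍ_ : ℤ[i] → ℤ[i]
-ᵍ (a + b i) = (- a) + (- b) i

_-ᵍ_ : ℤ[i] → ℤ[i] → ℤ[i]
x -ᵍ y = x +ᵍ (-ᵍ y)

+ᵍ-assoc : ∀ x y z → (x +ᵍ y) +ᵍ z ≡ x +ᵍ (y +ᵍ z)
+ᵍ-assoc (a + b i) (c + d i) (e + f i) = cong₂ _+_i (ℤ.+-assoc a c e) (ℤ.+-assoc b d f)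

+ᵍ-comm : ∀ x y → x +ᵍ y ≡ y +ᵍ x
+ᵍ-comm (a + b i) (c + d i) = cong₂ _+_i (ℤ.+-comm a c) (ℤ.+-comm b d)

+ᵍ-identityˡ : ∀ x → 0ᵍ +ᵍ x ≡ x
+ᵍ-identityˡ (a + b i) = cong₂ _+_i (ℤ.+-identityˡ a) (ℤ.+-identityˡ b)

+ᵍ-identityʳ : ∀ x → x +ᵍ 0ᵍ ≡ x
+ᵍ-identityʳ (a + b i) = cong₂ _+_i (ℤ.+-identityʳ a) (ℤ.+-identityʳ b)

+ᵍ-inverseˡ : ∀ x → (-ᵍ x) +ᵍ x ≡ 0ᵍ
+ᵍ-inverseˡ (a + b i) = cong₂ _+_i (ℤ.+-inverseˡ a) (ℤ.+-inverseˡ b)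

+ᵍ-inverseʳ : ∀ x → x +ᵍ (-ᵍ x) ≡ 0ᵍ
+ᵍ-inverseʳ (a + b i) = cong₂ _+_i (ℤ.+-inverseʳ a) (ℤ.+-inverseʳ b)

*ᵍ-assoc : ∀ x y z → (x *ᵍ y) *ᵍ z ≡ x *ᵍ (y *ᵍ z)
*ᵍ-assoc (a + b i) (c + d i) (e + f i) = cong₂ _+_i (re-assoc a b c d e f) (im-assoc a b c d e f)
  where
  re-assoc : ∀ a b c d e f → (a * c - b * d) * e - (a * d + b * c) * f ≡ a * (c * e - d * f) - b * (c * f + d * e)
  re-assoc = ℤ-Solver.solve-∀
  im-assoc : ∀ a b c d e f → (a * c - b * d) * f + (a * d + b * c) * e ≡ a * (c * f + d * e) + b * (c * e - d * f)
  im-assoc = ℤ-Solver.solve-∀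

*ᵍ-comm : ∀ x y → x *ᵍ y ≡ y *ᵍ x
*ᵍ-comm (a + b i) (c + d i) = cong₂ _+_i (re-comm a b c d) (im-comm a b c d)
  where
  re-comm : ∀ a b c d → a * c - b * d ≡ c * a - d * b
  re-comm = ℤ-Solver.solve-∀
  im-comm : ∀ a b c d → a * d + b * c ≡ c * b + d * a
  im-comm = ℤ-Solver.solve-∀

*ᵍ-identityˡ : ∀ x → 1ᵍ *ᵍ x ≡ x
*ᵍ-identityˡ (a + b i) = cong₂ _+_i (re-identity a b) (im-identity a b)
  where
  re-identity : ∀ a b → + 1 * a - + 0 * b ≡ a
  re-identity = ℤ-Solver.solve-∀
  im-identity : ∀ a b → + 1 * b + + 0 * a ≡ b
  im-identity = ℤ-Solver.solve-∀

*ᵍ-distribˡ-+ᵍ : ∀ x y z → x *ᵍ (y +ᵍ z) ≡ (x *ᵍ y) +ᵍ (x *ᵍ z)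
*ᵍ-distribˡ-+ᵍ (a + b i) (c + d i) (e + f i) = cong₂ _+_i (re-distrib a b c d e f) (im-distrib a b c d e f)
  where
  re-distrib : ∀ a b c d e f → a * (c + e) - b * (d + f) ≡ (a * c - b * d) + (a * e - b * f)
  re-distrib = ℤ-Solver.solve-∀
  im-distrib : ∀ a b c d e f → a * (d + f) + b * (c + e) ≡ (a * d + b * c) + (a * f + b * e)
  im-distrib = ℤ-Solver.solve-∀

ℤ[i]-commutativeRing : CommutativeRing 0ℓ 0ℓ
ℤ[i]-commutativeRing = record
  { isCommutativeRing = record
    { isRing = record
      { +-isAbelianGroup = record
        { isGroup = record
          { isMonoid = record
            { isSemigroup = record
              { isMagma = record { isEquivalence = isEquivalence ; ∙-cong = cong₂ _+ᵍ_ }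
              ; assoc = +ᵍ-assoc }
            ; identity = +ᵍ-identityˡ , +ᵍ-identityʳ }
          ; inverse = +ᵍ-inverseˡ , +ᵍ-inverseʳ
          ; ⁻¹-cong = cong (λ z → -ᵍ z) }
        ; comm = +ᵍ-comm }
      ; *-cong = cong₂ _*ᵍ_
      ; *-assoc = *ᵍ-assoc
      ; *-identity = *ᵍ-identityˡ , *ᵍ-identityʳ
      ; distrib = *ᵍ-distribˡ-+ᵍ , *ᵍ-distribʳ-+ᵍ }
    ; *-comm = *ᵍ-comm } }
  where
  *ᵍ-identityʳ : ∀ x → x *ᵍ 1ᵍ ≡ x
  *ᵍ-identityʳ x = trans (*ᵍ-comm x 1ᵍ) (*ᵍ-identityˡ x)
  *ᵍ-distribʳ-+ᵍ : ∀ x y z → (y +ᵍ z) *ᵍ x ≡ (y *ᵍ x) +ᵍ (z *ᵍ x)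
  *ᵍ-distribʳ-+ᵍ x y z =
    trans (*ᵍ-comm (y +ᵍ z) x) (trans (*ᵍ-distribˡ-+ᵍ x y z) (cong₂ _+ᵍ_ (*ᵍ-comm x y) (*ᵍ-comm x z)))

0ᵍ≟_ : ∀ z → Maybe (0ᵍ ≡ z)
0ᵍ≟ (a + b i) with + 0 ℤ.≟ a | + 0 ℤ.≟ b
... | yes refl | yes refl = just refl
... | _        | _        = nothing

ℤ[i]-ring : AlmostCommutativeRing 0ℓ 0ℓ
ℤ[i]-ring = fromCommutativeRing ℤ[i]-commutativeRing 0ᵍ≟_

norm : ℤ[i] → ℕ
norm (a + b i) = ∣ a ∣ ℕ.* ∣ a ∣ ℕ.+ ∣ b ∣ ℕ.* ∣ b ∣

conj : ℤ[i] → ℤ[i]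
conj (a + b i) = a + (- b) i

pos-square : ∀ a → + (∣ a ∣ ℕ.* ∣ a ∣) ≡ a * a
pos-square (+ n)    = ℤ.pos-* n n
pos-square -[1+ n ] = refl

pos-norm : ∀ z → + norm z ≡ re z * re z + im z * im z
pos-norm (a + b i) = cong₂ _+_ (pos-square a) (pos-square b)

norm-*ᵍ : ∀ x y → norm (x *ᵍ y) ≡ norm x ℕ.* norm y
norm-*ᵍ x@(a + b i) y@(c + d i) = ℤ.+-injective (begin
  + norm (x *ᵍ y)                                                         ≡⟨ pos-norm (x *ᵍ y) ⟩
  (a * c - b * d) * (a * c - b * d) + (a * d + b * c) * (a * d + b * c)   ≡⟨ two-squares a b c d ⟩
  (a * a + b * b) * (c * c + d * d)                                       ≡⟨ cong₂ _*_ (pos-norm x) (pos-norm y) ⟨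
  + norm x * + norm y                                                     ≡⟨ ℤ.pos-* (norm x) (norm y) ⟨
  + (norm x ℕ.* norm y)                                                   ∎)
  where
  open ≡-Reasoning
  two-squares : ∀ a b c d →
    (a * c - b * d) * (a * c - b * d) + (a * d + b * c) * (a * d + b * c) ≡ (a * a + b * b) * (c * c + d * d)
  two-squares = ℤ-Solver.solve-∀

norm-β*ᵍ : ∀ z → norm (β *ᵍ z) ≡ 2 ℕ.* norm z
norm-β*ᵍ = norm-*ᵍ β

norm-conj : ∀ z → norm (conj z) ≡ norm z
norm-conj (a + b i) = cong (λ n → ∣ a ∣ ℕ.* ∣ a ∣ ℕ.+ n ℕ.* n) (ℤ.∣-i∣≡∣i∣ b)

norm≡0⇒≡0ᵍ : ∀ z → norm z ≡ 0 → z ≡ 0ᵍ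
norm≡0⇒≡0ᵍ (a + b i) eq = cong₂ _+_i (square≡0 a (ℕ.m+n≡0⇒m≡0 _ eq)) (square≡0 b (ℕ.m+n≡0⇒n≡0 _ eq))
  where
  square≡0 : ∀ c → ∣ c ∣ ℕ.* ∣ c ∣ ≡ 0 → c ≡ + 0
  square≡0 (+ zero) _ = refl

-- re (conj p *ᵍ q) is the Euclidean inner product of p and q.
norm-+ᵍ : ∀ p q → + norm (p +ᵍ q) ≡ + norm p + + norm q + + 2 * re (conj p *ᵍ q)
norm-+ᵍ p@(a + b i) q@(c + d i) = begin
  + norm (p +ᵍ q)                                                 ≡⟨ pos-norm (p +ᵍ q) ⟩
  (a + c) * (a + c) + (b + d) * (b + d)                           ≡⟨ polarisation a b c d ⟩
  (a * a + b * b) + (c * c + d * d) + + 2 * (a * c - - b * d)     ≡⟨ cong₂ (λ m n → m + n + + 2 * (a * c - - b * d)) (pos-norm p) (pos-norm q) ⟨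
  + norm p + + norm q + + 2 * re (conj p *ᵍ q)                    ∎
  where
  open ≡-Reasoning
  polarisation : ∀ a b c d →
    (a + c) * (a + c) + (b + d) * (b + d) ≡ (a * a + b * b) + (c * c + d * d) + + 2 * (a * c - - b * d)
  polarisation = ℤ-Solver.solve-∀

cauchy-schwarz : ∀ p q → ∣ re (conj p *ᵍ q) ∣ ℕ.* ∣ re (conj p *ᵍ q) ∣ ℕ.≤ norm p ℕ.* norm q
cauchy-schwarz p@(_ + _ i) q@(_ + _ i) = begin
  ∣ re w ∣ ℕ.* ∣ re w ∣       ≤⟨ ℕ.m≤m+n _ _ ⟩
  norm w                      ≡⟨ norm-*ᵍ (conj p) q ⟩
  norm (conj p) ℕ.* norm q    ≡⟨ cong (ℕ._* norm q) (norm-conj p) ⟩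
  norm p ℕ.* norm q           ∎
  where
  open ℕ.≤-Reasoning
  w : ℤ[i]
  w = conj p *ᵍ q

i≤∣i∣ : ∀ i → i ℤ.≤ + ∣ i ∣
i≤∣i∣ (+ n)    = ℤ.≤-refl
i≤∣i∣ -[1+ n ] = -≤+

square-<⇒< : ∀ {m n} → m ℕ.* m ℕ.< n ℕ.* n → m ℕ.< n
square-<⇒< {m} {n} m²<n² with m ℕ.<? n
... | yes m<n = m<n
... | no  m≮n = ⊥-elim (ℕ.<⇒≱ m²<n² (ℕ.*-mono-≤ n≤m n≤m))
  where
  n≤m : n ℕ.≤ m
  n≤m = ℕ.≮⇒≥ m≮n

-- The triangle inequality |p + q| ≤ |p| + |q|, with √(a b) rounded down to s.
norm-+ᵍ-≤ : ∀ p q {a b s} → norm p ℕ.≤ a → norm q ℕ.≤ b → a ℕ.* b ℕ.< suc s ℕ.* suc s →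
            norm (p +ᵍ q) ℕ.≤ a ℕ.+ b ℕ.+ 2 ℕ.* s
norm-+ᵍ-≤ p q {a} {b} {s} p≤a q≤b ab<[1+s]² = ℤ.drop‿+≤+ (begin
  + norm (p +ᵍ q)                                ≡⟨ norm-+ᵍ p q ⟩
  + norm p + + norm q + + 2 * re (conj p *ᵍ q)   ≤⟨ ℤ.+-mono-≤ (ℤ.+-mono-≤ (+≤+ p≤a) (+≤+ q≤b)) (ℤ.*-monoˡ-≤-nonNeg (+ 2) ⟪p,q⟫≤s) ⟩
  + a + + b + + 2 * + s                          ≡⟨ cong (λ t → + a + + b + t) (ℤ.pos-* 2 s) ⟨
  + (a ℕ.+ b ℕ.+ 2 ℕ.* s)                        ∎)
  where
  open ℤ.≤-Reasoning
  ⟪p,q⟫≤s : re (conj p *ᵍ q) ℤ.≤ + s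
  ⟪p,q⟫≤s = ℤ.≤-trans (i≤∣i∣ _) (+≤+ (ℕ.s≤s⁻¹ (square-<⇒<
    (ℕ.≤-<-trans (ℕ.≤-trans (cauchy-schwarz p q) (ℕ.*-mono-≤ p≤a q≤b)) ab<[1+s]²))))

-- z ≡ 1 modulo β: as ℤ[i]/(β) has two elements, these are exactly the non-multiples of β.
Odd : ℤ[i] → Set
Odd z = ∃[ w ] z ≡ 1ᵍ +ᵍ (β *ᵍ w)

split-residue : ∀ a b r q → a + b ≡ r + q * + 2 → ∃[ w ] a + b i ≡ (r + (+ 0) i) +ᵍ (β *ᵍ w)
split-residue a b r q a+b≡r+2q = q + (q - a + r) i , cong₂ _+_i (re-part a q r) (begin
  b                                  ≡⟨ b≡[a+b]-a a b ⟩
  (a + b) - a                        ≡⟨ cong (_- a) a+b≡r+2q ⟩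
  (r + q * + 2) - a                  ≡⟨ im-part a q r ⟩
  + 0 + (+ 1 * (q - a + r) + + 1 * q) ∎)
  where
  open ≡-Reasoning
  re-part : ∀ a q r → a ≡ r + (+ 1 * q - + 1 * (q - a + r))
  re-part = ℤ-Solver.solve-∀
  b≡[a+b]-a : ∀ a b → b ≡ (a + b) - a
  b≡[a+b]-a = ℤ-Solver.solve-∀
  im-part : ∀ a q r → (r + q * + 2) - a ≡ + 0 + (+ 1 * (q - a + r) + + 1 * q)
  im-part = ℤ-Solver.solve-∀

-- Since i ≡ 1 modulo β, the parity of a + b i is that of a + b.
even-or-odd : ∀ z → (∃[ w ] z ≡ β *ᵍ w) ⊎ Odd z
even-or-odd (a + b i) with (a + b) %ℕ 2 | n%ℕd<d (a + b) 2 | a≡a%ℕn+[a/ℕn]*n (a + b) 2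
... | 0           | _            | a+b≡2q   =
  inj₁ (map₂ (λ eq → trans eq (+ᵍ-identityˡ _)) (split-residue a b (+ 0) ((a + b) /ℕ 2) a+b≡2q))
... | 1           | _            | a+b≡1+2q =
  inj₂ (split-residue a b (+ 1) ((a + b) /ℕ 2) a+b≡1+2q)
... | suc (suc _) | s≤s (s≤s ()) | _

odd≢even : ∀ t k → + 1 + t * + 2 ≢ k * + 2
odd≢even t k eq = 1≢2m (k - t) (begin
  + 1                       ≡⟨ 1≡[1+2t]-2t t ⟩
  (+ 1 + t * + 2) - t * + 2 ≡⟨ cong (_- t * + 2) eq ⟩
  k * + 2 - t * + 2         ≡⟨ factor-2 k t ⟩
  (k - t) * + 2             ∎)
  where
  open ≡-Reasoning
  1≡[1+2t]-2t : ∀ t → + 1 ≡ (+ 1 + t * + 2) - t * + 2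
  1≡[1+2t]-2t = ℤ-Solver.solve-∀
  factor-2 : ∀ k t → k * + 2 - t * + 2 ≡ (k - t) * + 2
  factor-2 = ℤ-Solver.solve-∀
  1≢2m : ∀ m → + 1 ≢ m * + 2
  1≢2m (+ zero)  ()
  1≢2m +[1+ n ]  ()
  1≢2m -[1+ n ]  ()

odd-norm≢2* : ∀ {z} → Odd z → ∀ k → norm z ≢ 2 ℕ.* k
odd-norm≢2* (c + d i , refl) k norm≡2k = odd≢even (c - d + c * c + d * d) (+ k) (begin
  + 1 + (c - d + c * c + d * d) * + 2   ≡⟨ odd-square-sum c d ⟨
  _                                     ≡⟨ pos-norm (1ᵍ +ᵍ (β *ᵍ (c + d i))) ⟨
  + norm (1ᵍ +ᵍ (β *ᵍ (c + d i)))       ≡⟨ cong +_ norm≡2k ⟩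
  + (2 ℕ.* k)                           ≡⟨ ℤ.pos-* 2 k ⟩
  + 2 * + k                             ≡⟨ ℤ.*-comm (+ 2) (+ k) ⟩
  + k * + 2                             ∎)
  where
  open ≡-Reasoning
  odd-square-sum : ∀ c d →
    (+ 1 + (+ 1 * c - + 1 * d)) * (+ 1 + (+ 1 * c - + 1 * d)) + (+ 0 + (+ 1 * d + + 1 * c)) * (+ 0 + (+ 1 * d + + 1 * c))
      ≡ + 1 + (c - d + c * c + d * d) * + 2
  odd-square-sum = ℤ-Solver.solve-∀

β*ᵍ-not-odd : ∀ w → ¬ Odd (β *ᵍ w)
β*ᵍ-not-odd w β*w-odd = odd-norm≢2* β*w-odd (norm w) (norm-β*ᵍ w)

odd⇒≢0ᵍ : ∀ {z} → Odd z → z ≢ 0ᵍ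
odd⇒≢0ᵍ z-odd refl = β*ᵍ-not-odd 0ᵍ z-odd

odd-+-β*ᵍ : ∀ {u} → Odd u → ∀ w → Odd (u +ᵍ (β *ᵍ w))
odd-+-β*ᵍ (c , refl) w = c +ᵍ w , regroup c w
  where
  regroup : ∀ c w → (1ᵍ +ᵍ (β *ᵍ c)) +ᵍ (β *ᵍ w) ≡ 1ᵍ +ᵍ (β *ᵍ (c +ᵍ w))
  regroup = solve-∀ ℤ[i]-ring

odd-difference : ∀ {z u} → Odd z → Odd u → ∃[ w ] z -ᵍ u ≡ β *ᵍ w
odd-difference (a , refl) (b , refl) = a -ᵍ b , difference a b
  where
  difference : ∀ a b → (1ᵍ +ᵍ (β *ᵍ a)) -ᵍ (1ᵍ +ᵍ (β *ᵍ b)) ≡ β *ᵍ (a -ᵍ b)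
  difference = solve-∀ ℤ[i]-ring

β*ᵍ-injective : ∀ {u v} → β *ᵍ u ≡ β *ᵍ v → u ≡ v
β*ᵍ-injective {u} {v} βu≡βv = begin
  u               ≡⟨ split u v ⟩
  (u -ᵍ v) +ᵍ v   ≡⟨ cong (_+ᵍ v) (norm≡0⇒≡0ᵍ (u -ᵍ v) (ℕ.m+n≡0⇒m≡0 _ 2*norm≡0)) ⟩
  0ᵍ +ᵍ v         ≡⟨ +ᵍ-identityˡ v ⟩
  v               ∎
  where
  open ≡-Reasoning
  split : ∀ u v → u ≡ (u -ᵍ v) +ᵍ v
  split = solve-∀ ℤ[i]-ring
  factor : ∀ u v → β *ᵍ (u -ᵍ v) ≡ (β *ᵍ u) -ᵍ (β *ᵍ v)
  factor = solve-∀ ℤ[i]-ring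
  2*norm≡0 : 2 ℕ.* norm (u -ᵍ v) ≡ 0
  2*norm≡0 = trans (sym (norm-β*ᵍ (u -ᵍ v)))
    (cong norm (trans (factor u v) (trans (cong (_-ᵍ (β *ᵍ v)) βu≡βv) (+ᵍ-inverseʳ (β *ᵍ v)))))

digit-zero-or-odd : ∀ d → d ≡ d0 ⊎ Odd (digitVal d)
digit-zero-or-odd d0  = inj₁ refl
digit-zero-or-odd d1  = inj₂ (0ᵍ , refl)
digit-zero-or-odd d-1 = inj₂ ((- (+ 1)) + (+ 1) i , refl)
digit-zero-or-odd di  = inj₂ (iᵍ , refl)
digit-zero-or-odd d-i = inj₂ ((- (+ 1)) + (+ 0) i , refl)

nonzero-digit-odd : ∀ {d} → d ≢ d0 → Odd (digitVal d)
nonzero-digit-odd {d} d≢d0 with digit-zero-or-odd d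
... | inj₁ d≡d0 = ⊥-elim (d≢d0 d≡d0)
... | inj₂ odd  = odd

i·ᵈ_ : Digit → Digit
i·ᵈ d0  = d0
i·ᵈ d1  = di
i·ᵈ di  = d-1
i·ᵈ d-1 = d-i
i·ᵈ d-i = d1

digitVal-i· : ∀ d → digitVal (i·ᵈ d) ≡ iᵍ *ᵍ digitVal d
digitVal-i· d0  = refl
digitVal-i· d1  = refl
digitVal-i· di  = refl
digitVal-i· d-1 = refl
digitVal-i· d-i = refl

-- The digits are 0 and the powers of i, so they are closed under multiplication.
_·ᵈ_ : Digit → Digit → Digit
d0  ·ᵈ e = d0
d1  ·ᵈ e = e
di  ·ᵈ e = i·ᵈ e
d-1 ·ᵈ e = i·ᵈ (i·ᵈ e)
d-i ·ᵈ e = i·ᵈ (i·ᵈ (i·ᵈ e))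

digitVal-· : ∀ d e → digitVal (d ·ᵈ e) ≡ digitVal d *ᵍ digitVal e
digitVal-· d0  e = 0≡0*x (digitVal e)
  where
  0≡0*x : ∀ x → 0ᵍ ≡ 0ᵍ *ᵍ x
  0≡0*x = solve-∀ ℤ[i]-ring
digitVal-· d1  e = sym (*ᵍ-identityˡ (digitVal e))
digitVal-· di  e = digitVal-i· e
digitVal-· d-1 e = trans (digitVal-i· (i·ᵈ e)) (trans (cong (iᵍ *ᵍ_) (digitVal-i· e)) (i²≡-1 (digitVal e)))
  where
  i²≡-1 : ∀ x → iᵍ *ᵍ (iᵍ *ᵍ x) ≡ digitVal d-1 *ᵍ x
  i²≡-1 = solve-∀ ℤ[i]-ring
digitVal-· d-i e = trans (digitVal-i· (i·ᵈ (i·ᵈ e)))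
  (trans (cong (iᵍ *ᵍ_) (digitVal-· d-1 e)) (i³≡-i (digitVal e)))
  where
  i³≡-i : ∀ x → iᵍ *ᵍ (digitVal d-1 *ᵍ x) ≡ digitVal d-i *ᵍ x
  i³≡-i = solve-∀ ℤ[i]-ring

-- B n z is Expansion (suc n) z by definition.
Expansion : ℕ → ℤ[i] → Set
Expansion k z = Σ (Vec Digit k) λ ds → evalDigits ds ≡ z

expansion-∷ : ∀ u {k w} → Expansion k w → Expansion (suc k) (digitVal u +ᵍ (β *ᵍ w))
expansion-∷ u (ds , refl) = u ∷ ds , refl

expansion-β*ᵍ : ∀ {k w} → Expansion k w → Expansion (suc k) (β *ᵍ w)
expansion-β*ᵍ (ds , refl) = d0 ∷ ds , +ᵍ-identityˡ _

expansion-extend : ∀ {k z} → Expansion k z → Expansion (suc k) z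
expansion-extend (ds , refl) = ds ∷ʳ d0 , evalDigits-∷ʳ-d0 ds
  where
  evalDigits-∷ʳ-d0 : ∀ {k} (ds : Vec Digit k) → evalDigits (ds ∷ʳ d0) ≡ evalDigits ds
  evalDigits-∷ʳ-d0 []       = refl
  evalDigits-∷ʳ-d0 (d ∷ ds) = cong (λ w → digitVal d +ᵍ (β *ᵍ w)) (evalDigits-∷ʳ-d0 ds)

expansion-digit*ᵍ : ∀ d {k z} → Expansion k z → Expansion k (digitVal d *ᵍ z)
expansion-digit*ᵍ d (ds , refl) = map (d ·ᵈ_) ds , evalDigits-map ds
  where
  0≡x*0 : ∀ x → 0ᵍ ≡ x *ᵍ 0ᵍ
  0≡x*0 = solve-∀ ℤ[i]-ring
  distribute : ∀ c u w → (c *ᵍ u) +ᵍ (β *ᵍ (c *ᵍ w)) ≡ c *ᵍ (u +ᵍ (β *ᵍ w))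
  distribute = solve-∀ ℤ[i]-ring
  evalDigits-map : ∀ {k} (ds : Vec Digit k) → evalDigits (map (d ·ᵈ_) ds) ≡ digitVal d *ᵍ evalDigits ds
  evalDigits-map []       = 0≡x*0 (digitVal d)
  evalDigits-map (e ∷ ds) = trans (cong₂ (λ u w → u +ᵍ (β *ᵍ w)) (digitVal-· d e) (evalDigits-map ds))
    (distribute (digitVal d) (digitVal e) (evalDigits ds))

-- The units digit of a β-multiple is 0, since a nonzero digit is odd.
expansion-β*ᵍ⁻¹ : ∀ {k w} → Expansion (suc k) (β *ᵍ w) → Expansion k w
expansion-β*ᵍ⁻¹ {w = w} (d ∷ ds , eq) with digit-zero-or-odd d
... | inj₁ refl  = ds , β*ᵍ-injective (trans (sym (+ᵍ-identityˡ _)) eq)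
... | inj₂ d-odd = ⊥-elim (β*ᵍ-not-odd w (subst Odd eq (odd-+-β*ᵍ d-odd (evalDigits ds))))

norm-digit≤1 : ∀ d → norm (digitVal d) ℕ.≤ 1
norm-digit≤1 d0  = z≤n
norm-digit≤1 d1  = ℕ.≤-refl
norm-digit≤1 d-1 = ℕ.≤-refl
norm-digit≤1 di  = ℕ.≤-refl
norm-digit≤1 d-i = ℕ.≤-refl

-- √1 + √2 < √6, and the norm is an integer.
norm-digit-pair≤5 : ∀ d e → norm (digitVal d +ᵍ (β *ᵍ digitVal e)) ℕ.≤ 5
norm-digit-pair≤5 d e = norm-+ᵍ-≤ (digitVal d) (β *ᵍ digitVal e) {s = 1} (norm-digit≤1 d) norm-β*e≤2 (ℕ.n≤1+n 3)
  where
  norm-β*e≤2 : norm (β *ᵍ digitVal e) ℕ.≤ 2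
  norm-β*e≤2 = subst (ℕ._≤ 2) (sym (norm-β*ᵍ (digitVal e))) (ℕ.*-monoʳ-≤ 2 (norm-digit≤1 e))

double : ℕ → ℕ
double zero    = zero
double (suc m) = suc (suc (double m))

mersenne : ℕ → ℕ
mersenne zero    = zero
mersenne (suc m) = suc (2 ℕ.* mersenne m)

suc-mersenne : ∀ m → suc (mersenne m) ≡ 2 ^ m
suc-mersenne zero    = refl
suc-mersenne (suc m) = trans (sym (ℕ.*-suc 2 (mersenne m))) (cong (2 ℕ.*_) (suc-mersenne m))

2^double : ∀ m → 2 ^ double m ≡ 2 ^ m ℕ.* 2 ^ m
2^double zero    = refl
2^double (suc m) = trans (cong (λ t → 2 ℕ.* (2 ℕ.* t)) (2^double m)) (regroup (2 ^ m))
  where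
  regroup : ∀ x → 2 ℕ.* (2 ℕ.* (x ℕ.* x)) ≡ (2 ℕ.* x) ℕ.* (2 ℕ.* x)
  regroup = ℕ-Solver.solve-∀

-- Pairs of digits are digits in base β² = 2 i, each of norm at most 5, hence
-- |z| ≤ √5 (1 + 2 + … + 2^(m-1)).
norm-double-length≤ : ∀ m (ds : Vec Digit (double m)) → norm (evalDigits ds) ℕ.≤ 5 ℕ.* (mersenne m ℕ.* mersenne m)
norm-double-length≤ zero    []           = z≤n
norm-double-length≤ (suc m) (d ∷ e ∷ ds) = begin
  norm (evalDigits (d ∷ e ∷ ds))
    ≡⟨ cong norm (regroup (digitVal d) (digitVal e) (evalDigits ds)) ⟩
  norm ((digitVal d +ᵍ (β *ᵍ digitVal e)) +ᵍ (β *ᵍ (β *ᵍ evalDigits ds)))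
    ≤⟨ norm-+ᵍ-≤ (digitVal d +ᵍ (β *ᵍ digitVal e)) (β *ᵍ (β *ᵍ evalDigits ds)) {s = 10 ℕ.* r} (norm-digit-pair≤5 d e) norm-tail≤ product<[1+s]² ⟩
  5 ℕ.+ 5 ℕ.* (2 ℕ.* r ℕ.* (2 ℕ.* r)) ℕ.+ 2 ℕ.* (10 ℕ.* r)
    ≡⟨ complete-square r ⟩
  5 ℕ.* (suc (2 ℕ.* r) ℕ.* suc (2 ℕ.* r)) ∎
  where
  open ℕ.≤-Reasoning
  r : ℕ
  r = mersenne m
  regroup : ∀ u v w → u +ᵍ (β *ᵍ (v +ᵍ (β *ᵍ w))) ≡ (u +ᵍ (β *ᵍ v)) +ᵍ (β *ᵍ (β *ᵍ w))
  regroup = solve-∀ ℤ[i]-ring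
  complete-square : ∀ r → 5 ℕ.+ 5 ℕ.* (2 ℕ.* r ℕ.* (2 ℕ.* r)) ℕ.+ 2 ℕ.* (10 ℕ.* r) ≡ 5 ℕ.* (suc (2 ℕ.* r) ℕ.* suc (2 ℕ.* r))
  complete-square = ℕ-Solver.solve-∀
  four-times : ∀ r → 2 ℕ.* (2 ℕ.* (5 ℕ.* (r ℕ.* r))) ≡ 5 ℕ.* (2 ℕ.* r ℕ.* (2 ℕ.* r))
  four-times = ℕ-Solver.solve-∀
  product-square : ∀ r → 5 ℕ.* (5 ℕ.* (2 ℕ.* r ℕ.* (2 ℕ.* r))) ≡ 10 ℕ.* r ℕ.* (10 ℕ.* r)
  product-square = ℕ-Solver.solve-∀
  norm-tail≤ : norm (β *ᵍ (β *ᵍ evalDigits ds)) ℕ.≤ 5 ℕ.* (2 ℕ.* r ℕ.* (2 ℕ.* r))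
  norm-tail≤ = begin
    norm (β *ᵍ (β *ᵍ evalDigits ds))    ≡⟨ trans (norm-β*ᵍ (β *ᵍ evalDigits ds)) (cong (2 ℕ.*_) (norm-β*ᵍ (evalDigits ds))) ⟩
    2 ℕ.* (2 ℕ.* norm (evalDigits ds))  ≤⟨ ℕ.*-monoʳ-≤ 2 (ℕ.*-monoʳ-≤ 2 (norm-double-length≤ m ds)) ⟩
    2 ℕ.* (2 ℕ.* (5 ℕ.* (r ℕ.* r)))     ≡⟨ four-times r ⟩
    5 ℕ.* (2 ℕ.* r ℕ.* (2 ℕ.* r))       ∎
  product<[1+s]² : 5 ℕ.* (5 ℕ.* (2 ℕ.* r ℕ.* (2 ℕ.* r))) ℕ.< suc (10 ℕ.* r) ℕ.* suc (10 ℕ.* r)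
  product<[1+s]² = subst (ℕ._< suc (10 ℕ.* r) ℕ.* suc (10 ℕ.* r)) (sym (product-square r))
    (ℕ.*-mono-< (ℕ.n<1+n (10 ℕ.* r)) (ℕ.n<1+n (10 ℕ.* r)))

parity-view : ∀ k → (∃[ m ] k ≡ double m) ⊎ (∃[ m ] k ≡ suc (double m))
parity-view zero = inj₁ (0 , refl)
parity-view (suc k) with parity-view k
... | inj₁ (m , refl) = inj₂ (m , refl)
... | inj₂ (m , refl) = inj₁ (suc m , refl)

norm-double-length< : ∀ m (ds : Vec Digit (double m)) → norm (evalDigits ds) ℕ.< 5 ℕ.* 2 ^ double m
norm-double-length< m ds = begin-strict
  norm (evalDigits ds)                          ≤⟨ norm-double-length≤ m ds ⟩
  5 ℕ.* (mersenne m ℕ.* mersenne m)             <⟨ ℕ.*-monoʳ-< 5 (ℕ.*-mono-< (ℕ.n<1+n (mersenne m)) (ℕ.n<1+n (mersenne m))) ⟩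
  5 ℕ.* (suc (mersenne m) ℕ.* suc (mersenne m)) ≡⟨ cong (λ t → 5 ℕ.* (t ℕ.* t)) (suc-mersenne m) ⟩
  5 ℕ.* (2 ^ m ℕ.* 2 ^ m)                       ≡⟨ cong (5 ℕ.*_) (2^double m) ⟨
  5 ℕ.* 2 ^ double m                            ∎
  where open ℕ.≤-Reasoning

-- An odd number of digits is made even by prepending a zero, which doubles the norm.
norm<5*2^ : ∀ {k z} → Expansion k z → norm z ℕ.< 5 ℕ.* 2 ^ k
norm<5*2^ {k} (ds , refl) with parity-view k
... | inj₁ (m , refl) = norm-double-length< m ds
... | inj₂ (m , refl) = ℕ.*-cancelˡ-< 2 _ _ (begin-strict
  2 ℕ.* norm (evalDigits ds)           ≡⟨ norm-β*ᵍ (evalDigits ds) ⟨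
  norm (β *ᵍ evalDigits ds)            ≡⟨ cong norm (+ᵍ-identityˡ (β *ᵍ evalDigits ds)) ⟨
  norm (evalDigits (d0 ∷ ds))          <⟨ norm-double-length< (suc m) (d0 ∷ ds) ⟩
  5 ℕ.* (2 ℕ.* 2 ^ suc (double m))     ≡⟨ swap (2 ^ suc (double m)) ⟩
  2 ℕ.* (5 ℕ.* 2 ^ suc (double m))     ∎)
  where
  open ℕ.≤-Reasoning
  swap : ∀ x → 5 ℕ.* (2 ℕ.* x) ≡ 2 ℕ.* (5 ℕ.* x)
  swap = ℕ-Solver.solve-∀

norm-drop : ∀ z u k → re z * re z + im z * im z ≡ (re (z -ᵍ u) * re (z -ᵍ u) + im (z -ᵍ u) * im (z -ᵍ u)) + + suc k →
            norm (z -ᵍ u) ℕ.< norm z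
norm-drop z u k eq = subst (norm (z -ᵍ u) ℕ.<_) (sym norm-z≡) (ℕ.m<m+n (norm (z -ᵍ u)) (s≤s z≤n))
  where
  norm-z≡ : norm z ≡ norm (z -ᵍ u) ℕ.+ suc k
  norm-z≡ = ℤ.+-injective (trans (pos-norm z) (trans eq (cong (_+ + suc k) (sym (pos-norm (z -ᵍ u))))))

-- For u = sign a we have |z - u|² = |z|² - 2|a| + 1, and likewise along the imaginary axis.
nearer-unit : ∀ z → z ≢ 0ᵍ → ∃[ u ] u ≢ d0 × norm (z -ᵍ digitVal u) ℕ.< norm z
nearer-unit z@(+[1+ p ] + b i) _ = d1 , (λ ()) , norm-drop z 1ᵍ (p ℕ.+ p) (shift (+ p) b)
  where
  shift : ∀ P b → (+ 1 + P) * (+ 1 + P) + b * b ≡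
    (((+ 1 + P) + - (+ 1)) * ((+ 1 + P) + - (+ 1)) + (b + - (+ 0)) * (b + - (+ 0))) + (+ 1 + (P + P))
  shift = ℤ-Solver.solve-∀
nearer-unit z@(-[1+ p ] + b i) _ = d-1 , (λ ()) , norm-drop z (digitVal d-1) (p ℕ.+ p) (shift (+ p) b)
  where
  shift : ∀ P b → - (+ 1 + P) * - (+ 1 + P) + b * b ≡
    ((- (+ 1 + P) + - - (+ 1)) * (- (+ 1 + P) + - - (+ 1)) + (b + - (+ 0)) * (b + - (+ 0))) + (+ 1 + (P + P))
  shift = ℤ-Solver.solve-∀
nearer-unit z@(+0 + +[1+ p ] i) _ = di , (λ ()) , norm-drop z iᵍ (p ℕ.+ p) (shift (+ p))
  where
  shift : ∀ P → + 0 * + 0 + (+ 1 + P) * (+ 1 + P) ≡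
    ((+ 0 + - (+ 0)) * (+ 0 + - (+ 0)) + ((+ 1 + P) + - (+ 1)) * ((+ 1 + P) + - (+ 1))) + (+ 1 + (P + P))
  shift = ℤ-Solver.solve-∀
nearer-unit z@(+0 + -[1+ p ] i) _ = d-i , (λ ()) , norm-drop z (digitVal d-i) (p ℕ.+ p) (shift (+ p))
  where
  shift : ∀ P → + 0 * + 0 + - (+ 1 + P) * - (+ 1 + P) ≡
    ((+ 0 + - (+ 0)) * (+ 0 + - (+ 0)) + (- (+ 1 + P) + - - (+ 1)) * (- (+ 1 + P) + - - (+ 1))) + (+ 1 + (P + P))
  shift = ℤ-Solver.solve-∀
nearer-unit (+0 + +0 i) z≢0 = ⊥-elim (z≢0 refl)

norm-β*ᵍ<2^suc : ∀ {k} w → norm (β *ᵍ w) ℕ.< 2 ^ suc k → norm w ℕ.< 2 ^ k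
norm-β*ᵍ<2^suc {k} w lt = ℕ.*-cancelˡ-< 2 (norm w) (2 ^ k) (subst (ℕ._< 2 ^ suc k) (norm-β*ᵍ w) lt)

odd-step : ∀ {k z} → Odd z → norm z ℕ.< 2 ^ suc k → ∃[ u ] ∃[ w ] z ≡ digitVal u +ᵍ (β *ᵍ w) × norm w ℕ.< 2 ^ k
odd-step {k} {z} z-odd norm<2^[1+k] with nearer-unit z (odd⇒≢0ᵍ z-odd)
... | u , u≢d0 , closer with odd-difference z-odd (nonzero-digit-odd u≢d0)
...   | w , z-u≡βw = u , w , z≡u+βw , norm-β*ᵍ<2^suc {k} w (begin-strict
  norm (β *ᵍ w)          ≡⟨ cong norm z-u≡βw ⟨
  norm (z -ᵍ digitVal u) <⟨ closer ⟩
  norm z                 <⟨ norm<2^[1+k] ⟩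
  2 ^ suc k              ∎)
  where
  open ℕ.≤-Reasoning
  u+[z-u]≡z : ∀ u z → u +ᵍ (z -ᵍ u) ≡ z
  u+[z-u]≡z = solve-∀ ℤ[i]-ring
  z≡u+βw : z ≡ digitVal u +ᵍ (β *ᵍ w)
  z≡u+βw = sym (trans (cong (digitVal u +ᵍ_) (sym z-u≡βw)) (u+[z-u]≡z (digitVal u) z))

expansion-of-norm< : ∀ k z → norm z ℕ.< 2 ^ k → Expansion k z
expansion-of-norm< zero    z norm<1 = [] , sym (norm≡0⇒≡0ᵍ z (ℕ.n<1⇒n≡0 norm<1))
expansion-of-norm< (suc k) z norm<2^[1+k] with even-or-odd z
... | inj₁ (w , refl) = expansion-β*ᵍ (expansion-of-norm< k w (norm-β*ᵍ<2^suc {k} w norm<2^[1+k]))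
... | inj₂ z-odd =
  let u , w , z≡u+βw , norm-w< = odd-step {k} z-odd norm<2^[1+k]
  in subst (Expansion (suc k)) (sym z≡u+βw) (expansion-∷ u (expansion-of-norm< k w norm-w<))

data Coordinate : ℤ → Set where
  is-0  : Coordinate (+ 0)
  is-1  : Coordinate (+ 1)
  is--1 : Coordinate (- (+ 1))
  large : ∀ {a} → 4 ℕ.≤ ∣ a ∣ ℕ.* ∣ a ∣ → Coordinate a

4≤square : ∀ n → 4 ℕ.≤ suc (suc n) ℕ.* suc (suc n)
4≤square n = ℕ.*-mono-≤ {2} {suc (suc n)} {2} {suc (suc n)} (s≤s (s≤s z≤n)) (s≤s (s≤s z≤n))

coordinate : ∀ a → Coordinate a
coordinate (+ 0)             = is-0
coordinate (+ 1)             = is-1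
coordinate (+ suc (suc n))   = large (4≤square n)
coordinate -[1+ 0 ]          = is--1
coordinate -[1+ suc n ]      = large (4≤square n)

odd-4≤norm⇒5≤norm : ∀ {y} → Odd y → 4 ℕ.≤ norm y → 5 ℕ.≤ norm y
odd-4≤norm⇒5≤norm y-odd 4≤norm = ℕ.≤∧≢⇒< 4≤norm (λ 4≡norm → odd-norm≢2* y-odd 2 (sym 4≡norm))

-- The odd Gaussian integers with both coordinates in {0, ±1} are the units.
unit-or-5≤norm : ∀ {y} → Odd y → (∃[ d ] digitVal d *ᵍ y ≡ 1ᵍ) ⊎ 5 ℕ.≤ norm y
unit-or-5≤norm {a + b i} y-odd with coordinate a | coordinate b
... | large 4≤a² | _          = inj₂ (odd-4≤norm⇒5≤norm y-odd (ℕ.≤-trans 4≤a² (ℕ.m≤m+n _ _)))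
... | _          | large 4≤b² = inj₂ (odd-4≤norm⇒5≤norm y-odd (ℕ.≤-trans 4≤b² (ℕ.m≤n+m _ _)))
... | is-1       | is-0       = inj₁ (d1 , refl)
... | is--1      | is-0       = inj₁ (d-1 , refl)
... | is-0       | is-1       = inj₁ (d-i , refl)
... | is-0       | is--1      = inj₁ (di , refl)
... | is-0       | is-0       = ⊥-elim (β*ᵍ-not-odd 0ᵍ y-odd)
... | is-1       | is-1       = ⊥-elim (β*ᵍ-not-odd 1ᵍ y-odd)
... | is-1       | is--1      = ⊥-elim (β*ᵍ-not-odd (digitVal d-i) y-odd)
... | is--1      | is-1       = ⊥-elim (β*ᵍ-not-odd iᵍ y-odd)
... | is--1      | is--1      = ⊥-elim (β*ᵍ-not-odd (digitVal d-1) y-odd)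

odd-cofactor : ∀ n x {y} → Odd y → B n (x *ᵍ y) → B n x
odd-cofactor n x {y} y-odd xy∈B with unit-or-5≤norm y-odd
... | inj₁ (d , dy≡1) = subst (B n) (cancel (digitVal d) x y dy≡1) (expansion-digit*ᵍ d xy∈B)
  where
  reassociate : ∀ c x y → c *ᵍ (x *ᵍ y) ≡ x *ᵍ (c *ᵍ y)
  reassociate = solve-∀ ℤ[i]-ring
  x*1≡x : ∀ x → x *ᵍ 1ᵍ ≡ x
  x*1≡x = solve-∀ ℤ[i]-ring
  cancel : ∀ c x y → c *ᵍ y ≡ 1ᵍ → c *ᵍ (x *ᵍ y) ≡ x
  cancel c x y cy≡1 = trans (reassociate c x y) (trans (cong (x *ᵍ_) cy≡1) (x*1≡x x))
... | inj₂ 5≤norm-y = expansion-of-norm< (suc n) x (ℕ.*-cancelˡ-< 5 (norm x) (2 ^ suc n) (begin-strict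
  5 ℕ.* norm x          ≤⟨ ℕ.*-monoˡ-≤ (norm x) 5≤norm-y ⟩
  norm y ℕ.* norm x     ≡⟨ ℕ.*-comm (norm y) (norm x) ⟩
  norm x ℕ.* norm y     ≡⟨ norm-*ᵍ x y ⟨
  norm (x *ᵍ y)         <⟨ norm<5*2^ xy∈B ⟩
  5 ℕ.* 2 ^ suc n       ∎))
  where open ℕ.≤-Reasoning

mainTheorem5 : (n : ℕ) (x y : ℤ[i]) → B n (x *ᵍ y) → x *ᵍ y ≢ 0ᵍ → B n x
mainTheorem5 n x y xy∈B xy≢0 with even-or-odd y
... | inj₂ y-odd        = odd-cofactor n x y-odd xy∈B
... | inj₁ (y' , refl) = cancel-β n (expansion-β*ᵍ⁻¹ (subst (B n) (β-out x y') xy∈B)) (xy≢0 ∘ β-times-zero)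
  where
  β-out : ∀ x y → x *ᵍ (β *ᵍ y) ≡ β *ᵍ (x *ᵍ y)
  β-out = solve-∀ ℤ[i]-ring
  β-times-zero : x *ᵍ y' ≡ 0ᵍ → x *ᵍ (β *ᵍ y') ≡ 0ᵍ
  β-times-zero xy'≡0 = trans (β-out x y') (cong (β *ᵍ_) xy'≡0)
  cancel-β : ∀ n → Expansion n (x *ᵍ y') → x *ᵍ y' ≢ 0ᵍ → B n x
  cancel-β zero    ([] , 0≡xy') xy'≢0 = ⊥-elim (xy'≢0 (sym 0≡xy'))
  cancel-β (suc n) xy'∈B        xy'≢0 = expansion-extend (mainTheorem5 n x y' xy'∈B xy'≢0)
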